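{- Let $n,k$ be positive integers with $4\le 2k\le n$, and let $\mathcal{G}\subseteq 2^{[n]}$ be a collection of subsets of $[n]$, each containing at most $k$ elements. Define $$\mathcal{F}(n,k,\mathcal{G})=\Big\{S\in\binom{[n]}{k} : S\preceq G \text{ for some } G\in\mathcal{G}\Big\}.$$ Then $\mathcal{F}(n,k,\mathcal{G})$ is intersecting if and only if for every $G,H\in\mathcal{G}$ (possibly identical) there exists an integer $l$ with $1\le l\le n$ such that $\mu_G(l)+\mu_H(l)>l$.
   Context: $[n]=\{1,\dots,n\}$ and $\binom{[n]}{k}$ denotes the collection of $k$-element subsets of $[n]$. Sets are listed in increasing order. For $A=\{a_1<\dots<a_r\}$ and $B=\{b_1<\dots<b_s\}$ subsets of $[n]$, write $A\preceq B$ if $r\ge s$ and $a_i\le b_i$ for all $1\le i\le s$. For a set $X\subseteq[n]$ and a positive integer $l$, $\mu_X(l)$ denotes the number of elements of $X$ that are at most $l$, i.e. $\mu_X(l)=|X\cap[l]|$. A family $\mathcal{A}$ is intersecting if $S\cap T\neq\emptyset$ for all $S,T\in\mathcal{A}$. -}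

module Defs where

open import Data.Nat using (ℕ; zero; suc; _≤_; _≤?_)
open import Data.Bool using (true; false)
open import Data.List using (List; []; _∷_; map; filter; length)
open import Data.Vec using ([]; _∷_)
open import Data.Product using (_×_; ∃-syntax)
open import Relation.Binary.PropositionalEquality using (_≡_)
open import Data.Fin.Subset using (Subset; _∩_; Nonempty; ∣_∣)

-- A subset of [n] is a 'Subset n'; position i : Fin n stands for the
-- element toℕ i + 1 of [n].

elems : ∀ {n} → Subset n → List ℕ
elems [] = []
elems (true ∷ p) = 1 ∷ map suc (elems p)
elems (false ∷ p) = map suc (elems p)

data _⪯ˡ_ : List ℕ → List ℕ → Set where
  ⪯-[] : ∀ {as} → as ⪯ˡ []
  ⪯-∷  : ∀ {a b as bs} → a ≤ b → as ⪯ˡ bs → (a ∷ as) ⪯ˡ (b ∷ bs)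

_⪯_ : ∀ {n} → Subset n → Subset n → Set
A ⪯ B = elems A ⪯ˡ elems B

μ : ∀ {n} → Subset n → ℕ → ℕ
μ X l = length (filter (_≤? l) (elems X))

Family : ℕ → Set₁
Family n = Subset n → Set

𝓕 : (n k : ℕ) → Family n → Family n
𝓕 n k 𝒢 S = ∣ S ∣ ≡ k × ∃[ G ] (𝒢 G × S ⪯ G)

Intersecting : ∀ {n} → Family n → Set
Intersecting 𝒜 = ∀ S T → 𝒜 S → 𝒜 T → Nonempty (S ∩ T)

{-# OPTIONS --safe #-}
module Submission where

-- S ⪯ G holds exactly when μ_S(l) ≥ μ_G(l) for every l (for sorted lists, termwise
-- domination is domination of the counting functions). So if μ_G(l) + μ_H(l) > l, members
-- S ⪯ G and T ⪯ H of 𝓕 have more than l elements in [l] between them and must meet.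
-- Conversely, if μ_G(l) + μ_H(l) ≤ l for all l, let T be the k smallest elements outside G
-- and S the k smallest elements outside T. Since μ_X(l) + μ_{∁X}(l) = min(l, n), the sparseness
-- hypothesis gives μ_T ≥ μ_H and then μ_S ≥ μ_G, and 2k ≤ n makes both sets have size k;
-- so S, T are disjoint members of 𝓕.

open import Defs
open import Data.Nat
open import Data.Nat.Properties
open import Data.List using (List; []; _∷_; map; filter; length)
open import Data.List.Properties using (filter-accept; filter-reject)
open import Data.List.Relation.Unary.All using (All; []; _∷_)
open import Data.List.Relation.Unary.Linked as Linked using ([]; [-]; _∷_)
open import Data.List.Relation.Unary.Linked.Properties as Linkedₚ using (Linked⇒All)
open import Data.List.Relation.Unary.Sorted.TotalOrder ≤-totalOrder using (Sorted)
open import Data.Vec using ([]; _∷_; here)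
open import Data.Product using (_×_; _,_; ∃-syntax; ∃₂)
open import Data.Empty using (⊥-elim)
open import Function.Base using (_∘_)
open import Relation.Nullary using (yes; no; contradiction)
open import Relation.Binary.PropositionalEquality
open import Function.Bundles using (_⇔_; mk⇔)
open import Data.Fin.Subset using (Subset; inside; outside; ∣_∣; _∩_; ∁; _⊆_; Nonempty; Empty)
open import Data.Fin.Subset.Properties
  using ( drop-∷-⊆; ⊆-refl; out⊆; s⊆s; nonempty?; x∈p∩q⁺; x∈p∩q⁻
        ; x∉p⇒x∈∁p; x∈∁p⇒x∉p; ∣∁p∣≡n∸∣p∣)

-- μ X l is count≤ l (elems X) by definition, so the list lemmas apply to subsets verbatim.
count≤ : ℕ → List ℕ → ℕ
count≤ l xs = length (filter (_≤? l) xs)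

count≤-∷-≤ : ∀ {l x} xs → x ≤ l → count≤ l (x ∷ xs) ≡ suc (count≤ l xs)
count≤-∷-≤ xs x≤l = cong length (filter-accept (_≤? _) {xs = xs} x≤l)

count≤-∷-≰ : ∀ {l x} xs → x ≰ l → count≤ l (x ∷ xs) ≡ count≤ l xs
count≤-∷-≰ xs x≰l = cong length (filter-reject (_≤? _) {xs = xs} x≰l)

count≤-antitone : ∀ l {as bs} → as ⪯ˡ bs → count≤ l bs ≤ count≤ l as
count≤-antitone l ⪯-[] = z≤n
count≤-antitone l {a ∷ as} {b ∷ bs} (⪯-∷ a≤b as⪯bs) with b ≤? l | a ≤? l
... | yes b≤l | yes a≤l
  rewrite count≤-∷-≤ bs b≤l | count≤-∷-≤ as a≤l = s≤s (count≤-antitone l as⪯bs)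
... | yes b≤l | no a≰l = contradiction (≤-trans a≤b b≤l) a≰l
... | no b≰l  | yes a≤l
  rewrite count≤-∷-≰ bs b≰l | count≤-∷-≤ as a≤l = m≤n⇒m≤1+n (count≤-antitone l as⪯bs)
... | no b≰l  | no a≰l
  rewrite count≤-∷-≰ bs b≰l | count≤-∷-≰ as a≰l = count≤-antitone l as⪯bs

count≤-all> : ∀ {l xs} → All (l <_) xs → count≤ l xs ≡ 0
count≤-all> [] = refl
count≤-all> {xs = _ ∷ xs} (l<x ∷ l<xs) = trans (count≤-∷-≰ xs (<⇒≱ l<x)) (count≤-all> l<xs)

count≤-below-head : ∀ {l x xs} → Sorted (x ∷ xs) → l < x → count≤ l (x ∷ xs) ≡ 0
count≤-below-head sorted l<x = count≤-all> (Linked⇒All ≤-trans l<x sorted)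

count≤-dominated⇒⪯ˡ : ∀ {xs ys} → Sorted xs → Sorted ys →
  (∀ l → count≤ l ys ≤ count≤ l xs) → xs ⪯ˡ ys
count≤-dominated⇒⪯ˡ {ys = []} _ _ _ = ⪯-[]
count≤-dominated⇒⪯ˡ {[]} {y ∷ ys} _ _ dom =
  contradiction (subst (_≤ 0) (count≤-∷-≤ ys (≤-refl {y})) (dom y)) λ ()
count≤-dominated⇒⪯ˡ {x ∷ xs} {y ∷ ys} sorted-xs sorted-ys dom =
  ⪯-∷ x≤y (count≤-dominated⇒⪯ˡ (Linked.tail sorted-xs) (Linked.tail sorted-ys) tail-dom)
  where
  x≤y : x ≤ y
  x≤y with x ≤? y
  ... | yes x≤y = x≤y
  ... | no x≰y = contradiction
    (subst₂ _≤_ (count≤-∷-≤ ys (≤-refl {y})) (count≤-below-head sorted-xs (≰⇒> x≰y)) (dom y))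
    λ ()
  tail-dom : ∀ l → count≤ l ys ≤ count≤ l xs
  tail-dom l with y ≤? l
  ... | yes y≤l = s≤s⁻¹ (subst₂ _≤_ (count≤-∷-≤ ys y≤l) (count≤-∷-≤ xs (≤-trans x≤y y≤l)) (dom l))
  ... | no y≰l = begin
    count≤ l ys       ≡⟨ count≤-∷-≰ ys y≰l ⟨
    count≤ l (y ∷ ys) ≡⟨ count≤-below-head sorted-ys (≰⇒> y≰l) ⟩
    0                 ≤⟨ z≤n ⟩
    count≤ l xs       ∎
    where open ≤-Reasoning

count≤-map-suc : ∀ l xs → count≤ (suc l) (map suc xs) ≡ count≤ l xs
count≤-map-suc l [] = refl
count≤-map-suc l (x ∷ xs) with x ≤? l
... | yes x≤l = begin
  count≤ (suc l) (suc x ∷ map suc xs) ≡⟨ count≤-∷-≤ (map suc xs) (s≤s x≤l) ⟩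
  suc (count≤ (suc l) (map suc xs))   ≡⟨ cong suc (count≤-map-suc l xs) ⟩
  suc (count≤ l xs)                   ≡⟨ count≤-∷-≤ xs x≤l ⟨
  count≤ l (x ∷ xs)                   ∎
  where open ≡-Reasoning
... | no x≰l = begin
  count≤ (suc l) (suc x ∷ map suc xs) ≡⟨ count≤-∷-≰ (map suc xs) (x≰l ∘ s≤s⁻¹) ⟩
  count≤ (suc l) (map suc xs)         ≡⟨ count≤-map-suc l xs ⟩
  count≤ l xs                         ≡⟨ count≤-∷-≰ xs x≰l ⟨
  count≤ l (x ∷ xs)                   ∎
  where open ≡-Reasoning

count≤-zero-map-suc : ∀ xs → count≤ 0 (map suc xs) ≡ 0
count≤-zero-map-suc [] = refl
count≤-zero-map-suc (_ ∷ xs) = count≤-zero-map-suc xs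

map-suc-sorted : ∀ {xs} → Sorted xs → Sorted (map suc xs)
map-suc-sorted = Linkedₚ.map⁺ ∘ Linked.map s≤s

elems-sorted : ∀ {n} (X : Subset n) → Sorted (elems X)
elems-sorted [] = []
elems-sorted (outside ∷ X) = map-suc-sorted (elems-sorted X)
elems-sorted (inside ∷ X) with elems X | elems-sorted X
... | []     | _      = [-]
... | _ ∷ _  | sorted = s≤s z≤n ∷ map-suc-sorted sorted

μ-dominated⇒⪯ : ∀ {n} (A B : Subset n) → (∀ l → μ B l ≤ μ A l) → A ⪯ B
μ-dominated⇒⪯ A B = count≤-dominated⇒⪯ˡ (elems-sorted A) (elems-sorted B)

μ-zero : ∀ {n} (X : Subset n) → μ X 0 ≡ 0
μ-zero [] = refl
μ-zero (inside ∷ X) = count≤-zero-map-suc (elems X)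
μ-zero (outside ∷ X) = count≤-zero-map-suc (elems X)

module _ {n} (X : Subset n) (l : ℕ) where

  μ-inside : μ (inside ∷ X) (suc l) ≡ suc (μ X l)
  μ-inside = cong suc (count≤-map-suc l (elems X))

  μ-outside : μ (outside ∷ X) (suc l) ≡ μ X l
  μ-outside = count≤-map-suc l (elems X)

μ-≤-∣∣ : ∀ {n} (X : Subset n) l → μ X l ≤ ∣ X ∣
μ-≤-∣∣ [] l = z≤n
μ-≤-∣∣ (x ∷ X) zero = subst (_≤ ∣ x ∷ X ∣) (sym (μ-zero (x ∷ X))) z≤n
μ-≤-∣∣ (inside ∷ X) (suc l) = subst (_≤ suc ∣ X ∣) (sym (μ-inside X l)) (s≤s (μ-≤-∣∣ X l))
μ-≤-∣∣ (outside ∷ X) (suc l) = subst (_≤ ∣ X ∣) (sym (μ-outside X l)) (μ-≤-∣∣ X l)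

μ-⊓ : ∀ {n} (X : Subset n) l → μ X l ≡ μ X (l ⊓ n)
μ-⊓ [] l = refl
μ-⊓ (x ∷ X) zero = refl
μ-⊓ (inside ∷ X) (suc l) =
  trans (μ-inside X l) (trans (cong suc (μ-⊓ X l)) (sym (μ-inside X _)))
μ-⊓ (outside ∷ X) (suc l) =
  trans (μ-outside X l) (trans (μ-⊓ X l) (sym (μ-outside X _)))

μ-∁ : ∀ {n} (X : Subset n) l → μ X l + μ (∁ X) l ≡ l ⊓ n
μ-∁ [] l = sym (⊓-zeroʳ l)
μ-∁ (x ∷ X) zero = cong₂ _+_ (μ-zero (x ∷ X)) (μ-zero (∁ (x ∷ X)))
μ-∁ (inside ∷ X) (suc l) =
  trans (cong₂ _+_ (μ-inside X l) (μ-outside (∁ X) l)) (cong suc (μ-∁ X l))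
μ-∁ (outside ∷ X) (suc l) =
  trans (cong₂ _+_ (μ-outside X l) (μ-inside (∁ X) l))
        (trans (+-suc (μ X l) _) (cong suc (μ-∁ X l)))

μ-mono : ∀ {n} {X Y : Subset n} → X ⊆ Y → ∀ l → μ X l ≤ μ Y l
μ-mono {X = []} {[]} _ l = z≤n
μ-mono {X = x ∷ X} {Y} _ zero = subst (_≤ μ Y 0) (sym (μ-zero (x ∷ X))) z≤n
μ-mono {X = inside ∷ X} {inside ∷ Y} X⊆Y (suc l) =
  subst₂ _≤_ (sym (μ-inside X l)) (sym (μ-inside Y l)) (s≤s (μ-mono (drop-∷-⊆ X⊆Y) l))
μ-mono {X = inside ∷ X} {outside ∷ Y} X⊆Y (suc l) with X⊆Y here
... | ()
μ-mono {X = outside ∷ X} {inside ∷ Y} X⊆Y (suc l) =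
  subst₂ _≤_ (sym (μ-outside X l)) (sym (μ-inside Y l)) (m≤n⇒m≤1+n (μ-mono (drop-∷-⊆ X⊆Y) l))
μ-mono {X = outside ∷ X} {outside ∷ Y} X⊆Y (suc l) =
  subst₂ _≤_ (sym (μ-outside X l)) (sym (μ-outside Y l)) (μ-mono (drop-∷-⊆ X⊆Y) l)

⊆∁⇒μ+μ≤ : ∀ {n} {X Y : Subset n} → Y ⊆ ∁ X → ∀ l → μ X l + μ Y l ≤ l ⊓ n
⊆∁⇒μ+μ≤ {n} {X} {Y} Y⊆∁X l = begin
  μ X l + μ Y l     ≤⟨ +-monoʳ-≤ (μ X l) (μ-mono Y⊆∁X l) ⟩
  μ X l + μ (∁ X) l ≡⟨ μ-∁ X l ⟩
  l ⊓ n             ∎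
  where open ≤-Reasoning

μ+μ≤⇒μ≤μ∁ : ∀ {n} (X Y : Subset n) {l} → μ X l + μ Y l ≤ l ⊓ n → μ Y l ≤ μ (∁ X) l
μ+μ≤⇒μ≤μ∁ X Y {l} bound = +-cancelˡ-≤ (μ X l) _ _ (subst (μ X l + μ Y l ≤_) (sym (μ-∁ X l)) bound)

disjoint⇒⊆∁ : ∀ {n} {S T : Subset n} → Empty (S ∩ T) → S ⊆ ∁ T
disjoint⇒⊆∁ S∩T-empty x∈S = x∉p⇒x∈∁p λ x∈T → S∩T-empty (_ , x∈p∩q⁺ (x∈S , x∈T))

⊆∁⇒disjoint : ∀ {n} {S T : Subset n} → S ⊆ ∁ T → Empty (S ∩ T)
⊆∁⇒disjoint {S = S} {T} S⊆∁T (_ , x∈S∩T) with x∈p∩q⁻ S T x∈S∩T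
... | x∈S , x∈T = x∈∁p⇒x∉p (S⊆∁T x∈S) x∈T

pigeonhole : ∀ {n} (S T : Subset n) {l} → l < μ S l + μ T l → Nonempty (S ∩ T)
pigeonhole {n} S T {l} l<μ with nonempty? (S ∩ T)
... | yes S∩T-nonempty = S∩T-nonempty
... | no S∩T-empty = contradiction (begin
  μ S l + μ T l ≡⟨ +-comm (μ S l) (μ T l) ⟩
  μ T l + μ S l ≤⟨ ⊆∁⇒μ+μ≤ (disjoint⇒⊆∁ S∩T-empty) l ⟩
  l ⊓ n         ≤⟨ m⊓n≤m l n ⟩
  l             ∎) (<⇒≱ l<μ)
  where open ≤-Reasoning

smallest : ∀ {n} → ℕ → Subset n → Subset n
smallest k [] = []
smallest zero (_ ∷ X) = outside ∷ smallest zero X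
smallest (suc k) (inside ∷ X) = inside ∷ smallest k X
smallest (suc k) (outside ∷ X) = outside ∷ smallest (suc k) X

smallest-⊆ : ∀ {n} k (X : Subset n) → smallest k X ⊆ X
smallest-⊆ k [] = ⊆-refl
smallest-⊆ zero (_ ∷ X) = out⊆ (smallest-⊆ zero X)
smallest-⊆ (suc k) (inside ∷ X) = s⊆s (smallest-⊆ k X)
smallest-⊆ (suc k) (outside ∷ X) = s⊆s (smallest-⊆ (suc k) X)

μ-smallest : ∀ {n} k (X : Subset n) l → μ (smallest k X) l ≡ k ⊓ μ X l
μ-smallest k [] l = sym (⊓-zeroʳ k)
μ-smallest k (x ∷ X) zero =
  trans (μ-zero (smallest k (x ∷ X))) (sym (trans (cong (k ⊓_) (μ-zero (x ∷ X))) (⊓-zeroʳ k)))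
μ-smallest zero (_ ∷ X) (suc l) = trans (μ-outside (smallest zero X) l) (μ-smallest zero X l)
μ-smallest (suc k) (inside ∷ X) (suc l) =
  trans (μ-inside (smallest k X) l)
        (trans (cong suc (μ-smallest k X l)) (cong (suc k ⊓_) (sym (μ-inside X l))))
μ-smallest (suc k) (outside ∷ X) (suc l) =
  trans (μ-outside (smallest (suc k) X) l)
        (trans (μ-smallest (suc k) X l) (cong (suc k ⊓_) (sym (μ-outside X l))))

∣smallest∣ : ∀ {n} k (X : Subset n) → ∣ smallest k X ∣ ≡ k ⊓ ∣ X ∣
∣smallest∣ k [] = sym (⊓-zeroʳ k)
∣smallest∣ zero (_ ∷ X) = ∣smallest∣ zero X
∣smallest∣ (suc k) (inside ∷ X) = cong suc (∣smallest∣ k X)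
∣smallest∣ (suc k) (outside ∷ X) = ∣smallest∣ (suc k) X

∣smallest-∁∣ : ∀ {n} k (X : Subset n) → k + ∣ X ∣ ≤ n → ∣ smallest k (∁ X) ∣ ≡ k
∣smallest-∁∣ k X k+∣X∣≤n = begin
  ∣ smallest k (∁ X) ∣ ≡⟨ ∣smallest∣ k (∁ X) ⟩
  k ⊓ ∣ ∁ X ∣          ≡⟨ cong (k ⊓_) (∣∁p∣≡n∸∣p∣ X) ⟩
  k ⊓ (_ ∸ ∣ X ∣)      ≡⟨ m≤n⇒m⊓n≡m (m+n≤o⇒m≤o∸n k k+∣X∣≤n) ⟩
  k                    ∎
  where open ≡-Reasoning

smallest-⪯ : ∀ {n} k (X Y : Subset n) → ∣ Y ∣ ≤ k → (∀ l → μ Y l ≤ μ X l) → smallest k X ⪯ Y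
smallest-⪯ k X Y ∣Y∣≤k Y≤X = μ-dominated⇒⪯ (smallest k X) Y λ l →
  subst (μ Y l ≤_) (sym (μ-smallest k X l)) (⊓-glb (≤-trans (μ-≤-∣∣ Y l) ∣Y∣≤k) (Y≤X l))

disjoint-⪯-pair : ∀ {n} k (G H : Subset n) → k + k ≤ n → ∣ G ∣ ≤ k → ∣ H ∣ ≤ k →
  (∀ l → l ≤ n → μ G l + μ H l ≤ l) →
  ∃₂ λ S T → (∣ S ∣ ≡ k × S ⪯ G) × (∣ T ∣ ≡ k × T ⪯ H) × Empty (S ∩ T)
disjoint-⪯-pair {n} k G H k+k≤n ∣G∣≤k ∣H∣≤k sparse =
  S , T , (∣S∣≡k , smallest-⪯ k (∁ T) G ∣G∣≤k G≤∁T) ,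
          (∣T∣≡k , smallest-⪯ k (∁ G) H ∣H∣≤k H≤∁G) ,
          ⊆∁⇒disjoint (smallest-⊆ k (∁ T))
  where
  T S : Subset n
  T = smallest k (∁ G)
  S = smallest k (∁ T)

  H≤∁G : ∀ l → μ H l ≤ μ (∁ G) l
  H≤∁G l = μ+μ≤⇒μ≤μ∁ G H (subst₂ (λ g h → g + h ≤ l ⊓ n) (sym (μ-⊓ G l)) (sym (μ-⊓ H l))
    (sparse (l ⊓ n) (m⊓n≤n l n)))

  G≤∁T : ∀ l → μ G l ≤ μ (∁ T) l
  G≤∁T l = μ+μ≤⇒μ≤μ∁ T G (subst (_≤ l ⊓ n) (+-comm (μ G l) (μ T l))
    (⊆∁⇒μ+μ≤ (smallest-⊆ k (∁ G)) l))

  ∣T∣≡k : ∣ T ∣ ≡ k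
  ∣T∣≡k = ∣smallest-∁∣ k G (≤-trans (+-monoʳ-≤ k ∣G∣≤k) k+k≤n)

  ∣S∣≡k : ∣ S ∣ ≡ k
  ∣S∣≡k = ∣smallest-∁∣ k T (subst (λ t → k + t ≤ n) (sym ∣T∣≡k) k+k≤n)

theorem1p1 : (n k : ℕ) → 4 ≤ 2 * k → 2 * k ≤ n →
    (𝒢 : Family n) → (∀ G → 𝒢 G → ∣ G ∣ ≤ k) →
    Intersecting (𝓕 n k 𝒢) ⇔
      (∀ G H → 𝒢 G → 𝒢 H → ∃[ l ] (1 ≤ l × l ≤ n × l < μ G l + μ H l))
theorem1p1 n k _ 2k≤n 𝒢 ∣𝒢∣≤k = mk⇔ overlapping intersecting
  where
  intersecting : (∀ G H → 𝒢 G → 𝒢 H → ∃[ l ] (1 ≤ l × l ≤ n × l < μ G l + μ H l)) →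
                 Intersecting (𝓕 n k 𝒢)
  intersecting overlaps S T (_ , G , G∈𝒢 , S⪯G) (_ , H , H∈𝒢 , T⪯H)
    with overlaps G H G∈𝒢 H∈𝒢
  ... | l , _ , _ , l<μ =
    pigeonhole S T (≤-trans l<μ (+-mono-≤ (count≤-antitone l S⪯G) (count≤-antitone l T⪯H)))

  overlapping : Intersecting (𝓕 n k 𝒢) →
                ∀ G H → 𝒢 G → 𝒢 H → ∃[ l ] (1 ≤ l × l ≤ n × l < μ G l + μ H l)
  overlapping 𝓕-intersecting G H G∈𝒢 H∈𝒢 with anyUpTo? (λ l → l <? μ G l + μ H l) (suc n)
  ... | yes (zero , _ , 0<μ) =
    contradiction (subst (0 <_) (cong₂ _+_ (μ-zero G) (μ-zero H)) 0<μ) λ ()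
  ... | yes (suc l , l<1+n , l<μ) = suc l , s≤s z≤n , s≤s⁻¹ l<1+n , l<μ
  ... | no no-overlap
    with disjoint-⪯-pair k G H (subst (_≤ n) (cong (k +_) (+-identityʳ k)) 2k≤n)
           (∣𝒢∣≤k G G∈𝒢) (∣𝒢∣≤k H H∈𝒢) (λ l l≤n → ≮⇒≥ λ l<μ → no-overlap (l , s≤s l≤n , l<μ))
  ... | S , T , (∣S∣≡k , S⪯G) , (∣T∣≡k , T⪯H) , S∩T-empty =
    ⊥-elim (S∩T-empty (𝓕-intersecting S T (∣S∣≡k , G , G∈𝒢 , S⪯G) (∣T∣≡k , H , H∈𝒢 , T⪯H)))
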